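{- Let $W$ be a finite word over a finite alphabet. Then the following two conditions are equivalent: (A) $W$ is a rich palindrome; (B) $P_W(n)+P_W(n+1)=C_W(n+1)-C_W(n)+2$ for each integer $0\leq n\leq |W|$.
   Context: For a finite word $W$, $|W|$ denotes its length. A factor of $W$ is a (possibly empty) contiguous block of letters of $W$. A palindrome is a word equal to its reversal (the empty word is a palindrome). $C_W(n)$ denotes the number of distinct factors of $W$ of length $n$, and $P_W(n)$ the number of distinct palindromic factors of $W$ of length $n$, for every integer $n\geq 0$ (so $C_W(0)=P_W(0)=1$ and $C_W(n)=P_W(n)=0$ for $n>|W|$). A finite word $W$ is called rich if it has exactly $|W|+1$ distinct palindromic factors, counting the empty word (this is the maximum possible number). -}

module Defs where

open import Data.Nat using (ℕ; zero; suc; _+_; _∸_; _≟_)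
open import Data.Fin using (Fin)
import Data.Fin.Properties as FinP
open import Data.List using (List; []; _∷_; length; take; drop; reverse; upTo; concatMap; filter; deduplicate)
open import Data.List.Properties using (≡-dec)
open import Relation.Binary.PropositionalEquality using (_≡_)
open import Relation.Nullary using (Dec)
open import Data.Product using (_×_)

Word : ℕ → Set
Word k = List (Fin k)

module _ {k : ℕ} where

  _≟w_ : (u v : Word k) → Dec (u ≡ v)
  _≟w_ = ≡-dec FinP._≟_

  IsPalindrome : Word k → Set
  IsPalindrome w = reverse w ≡ w

  isPalindrome? : (w : Word k) → Dec (IsPalindrome w)
  isPalindrome? w = reverse w ≟w w

  allFactors : Word k → List (Word k)
  allFactors W =
    concatMap (λ i → concatMap (λ j → take j (drop i W) ∷ []) (upTo (suc (length W ∸ i))))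
              (upTo (suc (length W)))

  factorsOfLength : ℕ → Word k → List (Word k)
  factorsOfLength n W = filter (λ u → length u ≟ n) (allFactors W)

  C : Word k → ℕ → ℕ
  C W n = length (deduplicate _≟w_ (factorsOfLength n W))

  P : Word k → ℕ → ℕ
  P W n = length (deduplicate _≟w_ (filter isPalindrome? (factorsOfLength n W)))

  -- W is rich: exactly |W| + 1 distinct palindromic factors (empty word included).
  IsRich : Word k → Set
  IsRich W = length (deduplicate _≟w_ (filter isPalindrome? (allFactors W))) ≡ length W + 1

  IsRichPalindrome : Word k → Set
  IsRichPalindrome W = IsRich W × IsPalindrome W

-- Key fact (new-palindrome): putting a letter b in front of V creates at most one new
-- palindromic factor, the longest palindromic prefix w of bV; every shorter palindromic
-- prefix is a proper prefix of w and so reappears, reversed, in the tail of w.  Hence every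
-- word X has at most |X| + 1 palindromic factors (palFactors-bound).
-- (A) ⇒ (B): induction over palindromes W = aVa (module Extension).  Richness of W forces V
-- to be rich and w to be new; the factors of W of length n ≤ |aV| are those of V, the prefix
-- of aV of length n and its reversal, so C and P grow by explicit increments (newFactors,
-- newPalindromes) satisfying the homogeneous equation.
-- (B) ⇒ (A): at n = |W| the equation forces P(|W|) = 1, so W is a palindrome; telescoping all
-- equations gives 2·Σₙ P(n) = 2(|W| + 1), so W is rich.
module Submission where

open import Defs
open import Data.Nat using (ℕ; zero; suc; _+_; _∸_; _≤_; _<_; z≤n; s≤s; s≤s⁻¹; z<s; _⊓_; ⌊_/2⌋)
open import Data.Nat.Properties
open import Data.Fin using (Fin)
open import Data.List using (List; []; _∷_; _++_; length; take; drop; reverse; upTo; concatMap; filter; deduplicate; [_])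
open import Data.List.Properties using (∷ʳ-injectiveˡ; ++-assoc; ++-identityʳ; reverse-++; reverse-involutive; length-++; length-reverse; length-take; take++drop≡id; ∷-injective; ∷-injectiveʳ)
open import Data.List.Membership.Propositional using (_∈_; _∉_)
open import Data.List.Membership.Propositional.Properties using (∈-++⁺ˡ; ∈-++⁺ʳ; ∈-++⁻; ∈-concatMap⁺; ∈-concatMap⁻; ∈-upTo⁺; ∈-filter⁺; ∈-filter⁻; deduplicate-∈⇔)
open import Data.List.Relation.Unary.Any as Any using (here; there)
open import Data.List.Relation.Unary.Unique.DecPropositional.Properties using (deduplicate-!)
open import Data.List.Membership.Propositional.Properties.WithK using (unique∧set⇒bag)
open import Data.List.Relation.Binary.BagAndSetEquality using (_∼[_]_; set; ∼bag⇒↭)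
open import Data.List.Relation.Binary.Permutation.Propositional.Properties using (↭-length)
open import Data.List.Relation.Binary.Permutation.Propositional.Properties.WithK using (dedup-++-↭)
open import Data.List.Relation.Binary.Disjoint.Propositional using (Disjoint)
open import Data.Product using (Σ; ∃₂; _×_; _,_; proj₁; proj₂)
open import Data.Sum using (_⊎_; inj₁; inj₂; [_,_]′)
open import Data.Empty using (⊥-elim)
open import Function using (_∘_)
open import Function.Bundles using (_⇔_; mk⇔; Equivalence)
open import Relation.Binary.Definitions using (DecidableEquality; tri<; tri≈; tri>)
open import Relation.Binary.PropositionalEquality hiding ([_])
open import Relation.Nullary using (¬_; yes; no)
open import Relation.Unary using (Decidable)
open import Data.Nat.Tactic.RingSolver using (solve-∀)
open import Data.List.Reverse using (reverseView; _∶_∶ʳ_) renaming ([] to reverse-[])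

module Distinct {A : Set} (_≟_ : DecidableEquality A) where
  open import Data.List.Membership.DecPropositional _≟_ using (_∈?_)

  card : List A → ℕ
  card xs = length (deduplicate _≟_ xs)

  card-cong : {xs ys : List A} → xs ∼[ set ] ys → card xs ≡ card ys
  card-cong {xs} {ys} xs∼ys = ↭-length (∼bag⇒↭ (unique∧set⇒bag
    (deduplicate-! _≟_ xs) (deduplicate-! _≟_ ys)
    (mk⇔ (to dedup ∘ to xs∼ys ∘ from dedup) (to dedup ∘ from xs∼ys ∘ from dedup))))
    where
    open Equivalence
    dedup : ∀ {zs z} → z ∈ zs ⇔ z ∈ deduplicate _≟_ zs
    dedup = deduplicate-∈⇔ _≟_

  card-++ : {xs ys : List A} → Disjoint xs ys → card (xs ++ ys) ≡ card xs + card ys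
  card-++ {xs} {ys} disj = trans (↭-length (dedup-++-↭ _≟_ disj)) (length-++ (deduplicate _≟_ xs))

  card-∷-∉ : {x : A} {xs : List A} → x ∉ xs → card (x ∷ xs) ≡ suc (card xs)
  card-∷-∉ {x} {xs} x∉xs = card-++ {x ∷ []} {xs} λ { (here refl , x∈xs) → x∉xs x∈xs }

  card-∷-∈ : {x : A} {xs : List A} → x ∈ xs → card (x ∷ xs) ≡ card xs
  card-∷-∈ x∈xs = card-cong (mk⇔ (λ { (here refl) → x∈xs ; (there m) → m }) there)

  card-∅ : {xs : List A} → (∀ {z} → z ∉ xs) → card xs ≡ 0
  card-∅ empty = card-cong {ys = []} (mk⇔ (⊥-elim ∘ empty) λ ())

  card-singleton : {x : A} {xs : List A} → x ∈ xs → (∀ {z} → z ∈ xs → z ≡ x) → card xs ≡ 1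
  card-singleton {x} x∈xs only-x = card-cong {ys = x ∷ []} (mk⇔ (here ∘ only-x) λ { (here refl) → x∈xs })

  card-∷-≤ : (x : A) (xs : List A) → card (x ∷ xs) ≤ suc (card xs)
  card-∷-≤ x xs with x ∈? xs
  ... | yes x∈xs = ≤-trans (≤-reflexive (card-∷-∈ x∈xs)) (n≤1+n _)
  ... | no x∉xs = ≤-reflexive (card-∷-∉ x∉xs)

greatest-below : {P : ℕ → Set} → Decidable P → P 0 → (m : ℕ) →
                 Σ ℕ λ n → n ≤ m × P n × (∀ {j} → j ≤ m → P j → j ≤ n)
greatest-below {P} P? P0 zero = 0 , z≤n , P0 , λ j≤0 _ → j≤0
greatest-below {P} P? P0 (suc m) with P? (suc m) | greatest-below P? P0 m
... | yes Pm | _ = suc m , ≤-refl , Pm , λ j≤ _ → j≤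
... | no ¬Pm | n , n≤m , Pn , greatest = n , m≤n⇒m≤1+n n≤m , Pn , below
  where
  below : ∀ {j} → j ≤ suc m → P j → j ≤ n
  below {j} j≤ Pj with j ≟ suc m
  ... | yes refl = ⊥-elim (¬Pm Pj)
  ... | no j≢ = greatest (m<1+n⇒m≤n (≤∧≢⇒< j≤ j≢)) Pj

module _ {k : ℕ} where

  Factor : Word k → Word k → Set
  Factor u W = ∃₂ λ x y → x ++ u ++ y ≡ W

  Prefix : Word k → Word k → Set
  Prefix u W = Σ (Word k) λ t → u ++ t ≡ W

  factor-refl : (W : Word k) → Factor W W
  factor-refl W = [] , [] , ++-identityʳ W

  factor-trans : {u v W : Word k} → Factor u v → Factor v W → Factor u W
  factor-trans {u} (x , y , refl) (x' , y' , refl) = x' ++ x , y ++ y' ,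
    (begin
      (x' ++ x) ++ u ++ y ++ y'  ≡⟨ ++-assoc x' x _ ⟩
      x' ++ x ++ u ++ y ++ y'    ≡⟨ cong (λ z → x' ++ x ++ z) (sym (++-assoc u y y')) ⟩
      x' ++ x ++ (u ++ y) ++ y'  ≡⟨ cong (x' ++_) (sym (++-assoc x (u ++ y) y')) ⟩
      x' ++ (x ++ u ++ y) ++ y'  ∎)
    where open ≡-Reasoning

  prefix⇒factor : {u W : Word k} → Prefix u W → Factor u W
  prefix⇒factor (t , eq) = [] , t , eq

  prefix-trans : {u v W : Word k} → Prefix u v → Prefix v W → Prefix u W
  prefix-trans {u} (t , refl) (t' , refl) = t ++ t' , sym (++-assoc u t t')

  factor-length : {u W : Word k} → Factor u W → length u ≤ length W
  factor-length {u} (x , y , refl) = begin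
      length u                    ≤⟨ m≤m+n (length u) (length y) ⟩
      length u + length y         ≡⟨ sym (length-++ u) ⟩
      length (u ++ y)             ≤⟨ m≤n+m _ (length x) ⟩
      length x + length (u ++ y)  ≡⟨ sym (length-++ x) ⟩
      length (x ++ u ++ y)        ∎
    where open ≤-Reasoning

  factor-full : {u W : Word k} → Factor u W → length u ≡ length W → u ≡ W
  factor-full {u} ([] , [] , eq) _ = trans (sym (++-identityʳ u)) eq
  factor-full {u} ([] , c ∷ y , refl) e = ⊥-elim (<-irrefl e (begin-strict
      length u                    <⟨ m<m+n (length u) z<s ⟩
      length u + length (c ∷ y)   ≡⟨ sym (length-++ u) ⟩
      length (u ++ c ∷ y)         ∎))
    where open ≤-Reasoning
  factor-full (c ∷ x , y , refl) e = ⊥-elim (<-irrefl e (s≤s (factor-length (x , y , refl))))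


  factor-∷⁺ : {u W : Word k} (a : Fin k) → Factor u W → Factor u (a ∷ W)
  factor-∷⁺ a (x , y , eq) = a ∷ x , y , cong (a ∷_) eq

  factor-∷⁻ : {u W : Word k} {a : Fin k} → Factor u (a ∷ W) → Factor u W ⊎ Prefix u (a ∷ W)
  factor-∷⁻ ([] , y , eq) = inj₂ (y , eq)
  factor-∷⁻ (c ∷ x , y , eq) = inj₁ (x , y , ∷-injectiveʳ eq)

  factor-reverse : {u W : Word k} → Factor u W → Factor (reverse u) (reverse W)
  factor-reverse {u} (x , y , refl) = reverse y , reverse x ,
    (begin
      reverse y ++ reverse u ++ reverse x    ≡⟨ sym (++-assoc (reverse y) _ _) ⟩
      (reverse y ++ reverse u) ++ reverse x  ≡⟨ cong (_++ reverse x) (sym (reverse-++ u y)) ⟩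
      reverse (u ++ y) ++ reverse x          ≡⟨ sym (reverse-++ x (u ++ y)) ⟩
      reverse (x ++ u ++ y)                  ∎)
    where open ≡-Reasoning

  factor-reverse-palindrome : {u W : Word k} → IsPalindrome W → Factor u W → Factor (reverse u) W
  factor-reverse-palindrome palW f = subst (Factor _) palW (factor-reverse f)

  prefix≡take : {u W : Word k} → Prefix u W → u ≡ take (length u) W
  prefix≡take {[]} _ = refl
  prefix≡take {a ∷ u} (t , refl) = cong (a ∷_) (prefix≡take {u} (t , refl))

  prefix-unique : {u v W : Word k} → Prefix u W → Prefix v W → length u ≡ length v → u ≡ v
  prefix-unique {W = W} pu pv e = trans (prefix≡take pu) (trans (cong (λ n → take n W) e) (sym (prefix≡take pv)))

  prefix-take : (n : ℕ) (W : Word k) → Prefix (take n W) W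
  prefix-take n W = drop n W , take++drop≡id n W

  prefix-≤ : {p q X : Word k} → Prefix p X → Prefix q X → length p ≤ length q → Prefix p q
  prefix-≤ {[]} {q} _ _ _ = q , refl
  prefix-≤ {a ∷ p} {[]} _ _ ()
  prefix-≤ {a ∷ p} {b ∷ q} {[]} (_ , ()) _ _
  prefix-≤ {a ∷ p} {b ∷ q} {c ∷ X} (t , ep) (s , eq) (s≤s le) with ∷-injective ep | ∷-injective eq
  ... | refl , ep' | refl , eq' with prefix-≤ (t , ep') (s , eq') le
  ...   | r , pr = r , cong (a ∷_) pr

  reverse-proper-prefix : {p q V : Word k} {b : Fin k} → Prefix p q → IsPalindrome q →
                          length p < length q → Prefix q (b ∷ V) → Factor (reverse p) V
  reverse-proper-prefix {p} {q} {V} {b} (t , pt) palq lt (s , qs) = split (reverse t) refl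
    where
    q-split : reverse t ++ reverse p ≡ q
    q-split = trans (sym (reverse-++ p t)) (trans (cong reverse pt) palq)
    split : (r : Word k) → r ≡ reverse t → Factor (reverse p) V
    split [] e = ⊥-elim (<-irrefl (trans (sym (length-reverse p)) (cong length (trans (cong (_++ reverse p) e) q-split))) lt)
    split (c ∷ r) e = r , s , ∷-injectiveʳ (begin
        c ∷ r ++ reverse p ++ s      ≡⟨ sym (++-assoc (c ∷ r) (reverse p) s) ⟩
        (c ∷ r ++ reverse p) ++ s    ≡⟨ cong (λ z → (z ++ reverse p) ++ s) e ⟩
        (reverse t ++ reverse p) ++ s ≡⟨ cong (_++ s) q-split ⟩
        q ++ s                       ≡⟨ qs ⟩
        b ∷ V                        ∎)
      where open ≡-Reasoning

  drop-factor : (n : ℕ) (W : Word k) → Factor (drop n W) W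
  drop-factor n W = take n W , [] , trans (cong (take n W ++_) (++-identityʳ _)) (take++drop≡id n W)

  drop-length-++ : (x z : Word k) → drop (length x) (x ++ z) ≡ z
  drop-length-++ [] z = refl
  drop-length-++ (a ∷ x) z = drop-length-++ x z

  ∈-allFactors⁻ : (W : Word k) {u : Word k} → u ∈ allFactors W → Factor u W
  ∈-allFactors⁻ W {u} u∈ with Any.satisfied (∈-concatMap⁻ _ {upTo (suc (length W))} u∈)
  ... | i , u∈ᵢ with Any.satisfied (∈-concatMap⁻ (λ j → take j (drop i W) ∷ []) {upTo (suc (length W ∸ i))} u∈ᵢ)
  ...   | j , here refl = factor-trans (prefix⇒factor (prefix-take j (drop i W))) (drop-factor i W)

  -- A factor x ++ u ++ y is listed at starting position |x| with length |u|.
  ∈-allFactors⁺ : {u W : Word k} → Factor u W → u ∈ allFactors W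
  ∈-allFactors⁺ {u} (x , y , refl) = ∈-concatMap⁺ column (Any.map (λ { refl → u∈column }) (∈-upTo⁺ x-fits))
    where
    W = x ++ u ++ y
    column : ℕ → List (Word k)
    column i = concatMap (λ j → take j (drop i W) ∷ []) (upTo (suc (length W ∸ i)))
    x-fits : length x < suc (length W)
    x-fits = s≤s (factor-length (prefix⇒factor {x} {W} (u ++ y , refl)))
    u-fits : length u < suc (length W ∸ length x)
    u-fits = s≤s (subst (length u ≤_) (sym (trans (cong (_∸ length x) (length-++ x)) (m+n∸m≡n (length x) _)))
                        (factor-length (prefix⇒factor {u} {u ++ y} (y , refl))))
    u-at : u ≡ take (length u) (drop (length x) W)
    u-at = trans (prefix≡take (y , refl)) (cong (take (length u)) (sym (drop-length-++ x (u ++ y))))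
    u∈column : u ∈ column (length x)
    u∈column = ∈-concatMap⁺ (λ j → take j (drop (length x) W) ∷ []) (Any.map (λ { refl → here u-at }) (∈-upTo⁺ u-fits))

  PalFactor : Word k → Word k → Set
  PalFactor u W = Factor u W × IsPalindrome u

  palFactors : Word k → List (Word k)
  palFactors W = filter isPalindrome? (allFactors W)

  palFactorsOfLength : ℕ → Word k → List (Word k)
  palFactorsOfLength n W = filter isPalindrome? (factorsOfLength n W)

  ∈-factorsOfLength⁻ : (n : ℕ) (W : Word k) {u : Word k} → u ∈ factorsOfLength n W → Factor u W × length u ≡ n
  ∈-factorsOfLength⁻ n W u∈ with ∈-filter⁻ (λ u → length u ≟ n) u∈
  ... | u∈′ , e = ∈-allFactors⁻ W u∈′ , e

  ∈-factorsOfLength⁺ : {n : ℕ} {u W : Word k} → Factor u W → length u ≡ n → u ∈ factorsOfLength n W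
  ∈-factorsOfLength⁺ {n} f e = ∈-filter⁺ (λ u → length u ≟ n) (∈-allFactors⁺ f) e

  ∈-palFactors⁻ : (W : Word k) {u : Word k} → u ∈ palFactors W → PalFactor u W
  ∈-palFactors⁻ W u∈ with ∈-filter⁻ isPalindrome? u∈
  ... | u∈′ , pal = ∈-allFactors⁻ W u∈′ , pal

  ∈-palFactors⁺ : {u W : Word k} → PalFactor u W → u ∈ palFactors W
  ∈-palFactors⁺ (f , pal) = ∈-filter⁺ isPalindrome? (∈-allFactors⁺ f) pal

  ∈-palFactorsOfLength⁻ : (n : ℕ) (W : Word k) {u : Word k} → u ∈ palFactorsOfLength n W → PalFactor u W × length u ≡ n
  ∈-palFactorsOfLength⁻ n W u∈ with ∈-filter⁻ isPalindrome? u∈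
  ... | u∈′ , pal with ∈-factorsOfLength⁻ n W u∈′
  ...   | f , e = (f , pal) , e

  ∈-palFactorsOfLength⁺ : {n : ℕ} {u W : Word k} → PalFactor u W → length u ≡ n → u ∈ palFactorsOfLength n W
  ∈-palFactorsOfLength⁺ (f , pal) e = ∈-filter⁺ isPalindrome? (∈-factorsOfLength⁺ f e) pal

  open Distinct (_≟w_ {k})

  length≡0 : {u : Word k} → length u ≡ 0 → u ≡ []
  length≡0 {[]} _ = refl

  C-zero : (X : Word k) → C X 0 ≡ 1
  C-zero X = card-singleton {xs = factorsOfLength 0 X} (∈-factorsOfLength⁺ ([] , X , refl) refl)
                            (λ u∈ → length≡0 (proj₂ (∈-factorsOfLength⁻ 0 X u∈)))

  P-zero : (X : Word k) → P X 0 ≡ 1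
  P-zero X = card-singleton {xs = palFactorsOfLength 0 X} (∈-palFactorsOfLength⁺ (([] , X , refl) , refl) refl)
                            (λ u∈ → length≡0 (proj₂ (∈-palFactorsOfLength⁻ 0 X u∈)))

  C-length : (X : Word k) → C X (length X) ≡ 1
  C-length X = card-singleton {xs = factorsOfLength (length X) X} (∈-factorsOfLength⁺ (factor-refl X) refl)
                              (λ u∈ → let (f , e) = ∈-factorsOfLength⁻ (length X) X u∈ in factor-full f e)

  P-length : (X : Word k) → IsPalindrome X → P X (length X) ≡ 1
  P-length X palX = card-singleton {xs = palFactorsOfLength (length X) X} (∈-palFactorsOfLength⁺ (factor-refl X , palX) refl)
                                   (λ u∈ → let ((f , _) , e) = ∈-palFactorsOfLength⁻ (length X) X u∈ in factor-full f e)

  P-length-nonpalindrome : (X : Word k) → ¬ IsPalindrome X → P X (length X) ≡ 0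
  P-length-nonpalindrome X ¬palX = card-∅ {palFactorsOfLength (length X) X} λ u∈ →
    let ((f , palu) , e) = ∈-palFactorsOfLength⁻ (length X) X u∈ in ¬palX (subst IsPalindrome (factor-full f e) palu)

  C-beyond : (X : Word k) {n : ℕ} → length X < n → C X n ≡ 0
  C-beyond X {n} lt = card-∅ {factorsOfLength n X} λ u∈ → let (f , e) = ∈-factorsOfLength⁻ n X u∈ in
    <-irrefl e (≤-<-trans (factor-length f) lt)

  P-beyond : (X : Word k) {n : ℕ} → length X < n → P X n ≡ 0
  P-beyond X {n} lt = card-∅ {palFactorsOfLength n X} λ u∈ → let ((f , _) , e) = ∈-palFactorsOfLength⁻ n X u∈ in
    <-irrefl e (≤-<-trans (factor-length f) lt)

  Equation : Word k → ℕ → Set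
  Equation W n = P W n + P W (suc n) + C W n ≡ C W (suc n) + 2

  Equations : Word k → Set
  Equations W = (n : ℕ) → n ≤ length W → Equation W n

  -- At n = |X| a palindrome satisfies the equation: 1 + 0 + 1 = 0 + 2.
  equation-at-length : (X : Word k) → IsPalindrome X → Equation X (length X)
  equation-at-length X palX
    rewrite P-length X palX | P-beyond X (n<1+n (length X)) | C-length X | C-beyond X (n<1+n (length X)) = refl

  record LongestPalPrefix (w X : Word k) : Set where
    field
      prefix     : Prefix w X
      palindrome : IsPalindrome w
      longest    : ∀ {q} → Prefix q X → IsPalindrome q → length q ≤ length w

  -- Every word has one: the greatest n ≤ |X| with take n X a palindrome (n = 0 qualifies).
  longestPalPrefix : (X : Word k) → Σ (Word k) λ w → LongestPalPrefix w X
  longestPalPrefix X with greatest-below (λ n → isPalindrome? (take n X)) refl (length X)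
  ... | n , n≤ , pal , greatest = take n X , record
    { prefix     = prefix-take n X
    ; palindrome = pal
    ; longest    = λ {q} pq palq → begin
        length q           ≤⟨ greatest (factor-length (prefix⇒factor pq)) (subst IsPalindrome (prefix≡take pq) palq) ⟩
        n                  ≡⟨ sym (m≤n⇒m⊓n≡m n≤) ⟩
        n ⊓ length X       ≡⟨ sym (length-take n X) ⟩
        length (take n X)  ∎
    }
    where open ≤-Reasoning

  palindrome-longestPalPrefix : {X : Word k} → IsPalindrome X → LongestPalPrefix X X
  palindrome-longestPalPrefix {X} palX = record
    { prefix     = [] , ++-identityʳ X
    ; palindrome = palX
    ; longest    = λ pq _ → factor-length (prefix⇒factor pq)
    }

  -- Appending a letter in front creates at most one new palindrome: the longest palindromic
  -- prefix.  Every other palindromic prefix is a proper prefix of it, hence occurs later.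
  new-palindrome : {b : Fin k} {u w V : Word k} → LongestPalPrefix w (b ∷ V) →
                   PalFactor u (b ∷ V) → Factor u V ⊎ u ≡ w
  new-palindrome {b} {u} {w} {V} L (f , palu) = [ inj₁ , from-prefix ]′ (factor-∷⁻ f)
    where
    open LongestPalPrefix L
    from-prefix : Prefix u (b ∷ V) → Factor u V ⊎ u ≡ w
    from-prefix pu with length u ≟ length w
    ... | yes e = inj₂ (prefix-unique pu prefix e)
    ... | no ne = inj₁ (subst (λ z → Factor z V) palu
                         (reverse-proper-prefix (prefix-≤ pu prefix (longest pu palu)) palindrome
                                                (≤∧≢⇒< (longest pu palu) ne) prefix))

  palFactors-∷ : {b : Fin k} {w V : Word k} → LongestPalPrefix w (b ∷ V) →
                 palFactors (b ∷ V) ∼[ set ] (w ∷ palFactors V)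
  palFactors-∷ {b} {w} {V} L = mk⇔ to from
    where
    open LongestPalPrefix L
    to : ∀ {u} → u ∈ palFactors (b ∷ V) → u ∈ w ∷ palFactors V
    to u∈ with ∈-palFactors⁻ (b ∷ V) u∈
    ... | pf@(_ , palu) with new-palindrome L pf
    ...   | inj₁ g = there (∈-palFactors⁺ (g , palu))
    ...   | inj₂ refl = here refl
    from : ∀ {u} → u ∈ w ∷ palFactors V → u ∈ palFactors (b ∷ V)
    from (here refl) = ∈-palFactors⁺ (prefix⇒factor prefix , palindrome)
    from (there u∈) with ∈-palFactors⁻ V u∈
    ... | f , palu = ∈-palFactors⁺ (factor-∷⁺ b f , palu)

  palFactors-bound : (X : Word k) → card (palFactors X) ≤ length X + 1
  palFactors-bound [] = ≤-refl
  palFactors-bound (b ∷ V) with longestPalPrefix (b ∷ V)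
  ... | w , L = begin
      card (palFactors (b ∷ V))  ≡⟨ card-cong (palFactors-∷ L) ⟩
      card (w ∷ palFactors V)    ≤⟨ card-∷-≤ w (palFactors V) ⟩
      suc (card (palFactors V))  ≤⟨ s≤s (palFactors-bound V) ⟩
      suc (length V + 1)         ∎
    where open ≤-Reasoning

-- The increments of the complexity functions when a palindrome V grows to aVa, as functions
-- of ℓ (the length of the longest palindromic prefix of aV) and of the length n ≤ |aV|:
-- there are 0 new factors of length n < ℓ, 1 of length ℓ, and 2 of each length n > ℓ;
-- the only new palindrome of length ≤ |aV| has length ℓ.
newFactors : ℕ → ℕ → ℕ
newFactors zero    zero    = 1
newFactors zero    (suc n) = 2
newFactors (suc ℓ) zero    = 0
newFactors (suc ℓ) (suc n) = newFactors ℓ n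

newPalindromes : ℕ → ℕ → ℕ
newPalindromes zero    zero    = 1
newPalindromes zero    (suc n) = 0
newPalindromes (suc ℓ) zero    = 0
newPalindromes (suc ℓ) (suc n) = newPalindromes ℓ n

newFactors-< : {ℓ n : ℕ} → n < ℓ → newFactors ℓ n ≡ 0
newFactors-< {suc ℓ} {zero}  _         = refl
newFactors-< {suc ℓ} {suc n} (s≤s n<ℓ) = newFactors-< n<ℓ

newFactors-≡ : (n : ℕ) → newFactors n n ≡ 1
newFactors-≡ zero    = refl
newFactors-≡ (suc n) = newFactors-≡ n

newFactors-> : {ℓ n : ℕ} → ℓ < n → newFactors ℓ n ≡ 2
newFactors-> {zero}  {suc n} _         = refl
newFactors-> {suc ℓ} {suc n} (s≤s ℓ<n) = newFactors-> ℓ<n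

newPalindromes-≡ : (n : ℕ) → newPalindromes n n ≡ 1
newPalindromes-≡ zero    = refl
newPalindromes-≡ (suc n) = newPalindromes-≡ n

newPalindromes-≢ : {ℓ n : ℕ} → n ≢ ℓ → newPalindromes ℓ n ≡ 0
newPalindromes-≢ {zero}  {zero}  n≢ℓ = ⊥-elim (n≢ℓ refl)
newPalindromes-≢ {zero}  {suc n} _   = refl
newPalindromes-≢ {suc ℓ} {zero}  _   = refl
newPalindromes-≢ {suc ℓ} {suc n} n≢ℓ = newPalindromes-≢ (n≢ℓ ∘ cong suc)

newCounts-step : (ℓ n : ℕ) → newPalindromes ℓ n + newPalindromes ℓ (suc n) + newFactors ℓ n ≡ newFactors ℓ (suc n)
newCounts-step zero    zero          = refl
newCounts-step zero    (suc n)       = refl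
newCounts-step (suc zero)    zero    = refl
newCounts-step (suc (suc ℓ)) zero    = refl
newCounts-step (suc ℓ) (suc n)       = newCounts-step ℓ n

newCounts-top : {ℓ N : ℕ} → ℓ ≤ N → newPalindromes ℓ N + newFactors ℓ N ≡ 2
newCounts-top {zero}  {zero}  _         = refl
newCounts-top {zero}  {suc N} _         = refl
newCounts-top {suc ℓ} {suc N} (s≤s ℓ≤N) = newCounts-top ℓ≤N

add-increments : {x y z t a b c d : ℕ} → x + y + z ≡ t → a + b + c ≡ d + 2 →
                 (x + a) + (y + b) + (z + c) ≡ (t + d) + 2
add-increments {x} {y} {z} {t} {a} {b} {c} {d} inc eq = begin
    (x + a) + (y + b) + (z + c)  ≡⟨ regroup x y z a b c ⟩
    (x + y + z) + (a + b + c)    ≡⟨ cong₂ _+_ inc eq ⟩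
    t + (d + 2)                  ≡⟨ sym (+-assoc t d 2) ⟩
    (t + d) + 2                  ∎
  where
  open ≡-Reasoning
  regroup : ∀ x y z a b c → (x + a) + (y + b) + (z + c) ≡ (x + y + z) + (a + b + c)
  regroup = solve-∀

module Extension {k : ℕ} (a : Fin k) (V : Word k) (palV : IsPalindrome V)
                 (w : Word k) (L : LongestPalPrefix w (a ∷ V)) where
  open Distinct (_≟w_ {k})
  open LongestPalPrefix L

  X W : Word k
  X = a ∷ V
  W = a ∷ (V ++ [ a ])

  ℓ : ℕ
  ℓ = length w

  ℓ≤|X| : ℓ ≤ length X
  ℓ≤|X| = factor-length (prefix⇒factor prefix)

  length-W : length W ≡ suc (length X)
  length-W = cong suc (trans (length-++ V) (+-comm (length V) 1))

  reverse-X : reverse X ≡ V ++ [ a ]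
  reverse-X = trans (reverse-++ [ a ] V) (cong (_++ [ a ]) palV)

  reverse-Va : reverse (V ++ [ a ]) ≡ X
  reverse-Va = trans (reverse-++ V [ a ]) (cong (a ∷_) palV)

  palW : IsPalindrome W
  palW = trans (reverse-++ [ a ] (V ++ [ a ])) (cong (_++ [ a ]) reverse-Va)

  factor-V⇒W : {u : Word k} → Factor u V → Factor u W
  factor-V⇒W f = factor-∷⁺ a (factor-trans f ([] , [ a ] , refl))

  reverse-factor-V : {u : Word k} → Factor (reverse u) V → Factor u V
  reverse-factor-V {u} f = subst (λ z → Factor z V) (reverse-involutive u) (factor-reverse-palindrome palV f)

  palFactor-Va⇒X : {u : Word k} → Factor u (V ++ [ a ]) → IsPalindrome u → Factor u X
  palFactor-Va⇒X f palu = subst₂ Factor palu reverse-Va (factor-reverse f)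

  palFactor-W : {u : Word k} → PalFactor u W → u ≡ W ⊎ u ≡ w ⊎ Factor u V
  palFactor-W {u} pf@(_ , palu) with new-palindrome (palindrome-longestPalPrefix palW) pf
  ... | inj₂ u≡W = inj₁ u≡W
  ... | inj₁ f with new-palindrome L (palFactor-Va⇒X f palu , palu)
  ...   | inj₁ g = inj₂ (inj₂ g)
  ...   | inj₂ u≡w = inj₂ (inj₁ u≡w)

  palFactorsOfLength-V⇒W : (n : ℕ) {u : Word k} → u ∈ palFactorsOfLength n V → u ∈ palFactorsOfLength n W
  palFactorsOfLength-V⇒W n u∈ with ∈-palFactorsOfLength⁻ n V u∈
  ... | (f , palu) , e = ∈-palFactorsOfLength⁺ (factor-V⇒W f , palu) e

  w-palFactor-W : PalFactor w W
  w-palFactor-W = prefix⇒factor (prefix-trans prefix ([ a ] , refl)) , palindrome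

  short-palFactor-W : {u : Word k} → PalFactor u W → length u ≤ length X → u ≡ w ⊎ Factor u V
  short-palFactor-W pf u≤ with palFactor-W pf
  ... | inj₁ refl = ⊥-elim (1+n≰n (subst (_≤ length X) length-W u≤))
  ... | inj₂ r = r

  palFactors-W : card (palFactors W) ≡ suc (card (w ∷ palFactors V))
  palFactors-W = trans (card-cong (mk⇔ to from)) (card-∷-∉ W∉)
    where
    to : ∀ {u} → u ∈ palFactors W → u ∈ W ∷ w ∷ palFactors V
    to u∈ with ∈-palFactors⁻ W u∈
    ... | pf@(_ , palu) with palFactor-W pf
    ...   | inj₁ refl = here refl
    ...   | inj₂ (inj₁ refl) = there (here refl)
    ...   | inj₂ (inj₂ g) = there (there (∈-palFactors⁺ (g , palu)))
    from : ∀ {u} → u ∈ W ∷ w ∷ palFactors V → u ∈ palFactors W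
    from (here refl) = ∈-palFactors⁺ (factor-refl W , palW)
    from (there (here refl)) = ∈-palFactors⁺ w-palFactor-W
    from (there (there u∈)) with ∈-palFactors⁻ V u∈
    ... | f , palu = ∈-palFactors⁺ (factor-V⇒W f , palu)
    short : ∀ {u} → u ∈ w ∷ palFactors V → length u ≤ length X
    short (here refl) = ℓ≤|X|
    short (there u∈) = m≤n⇒m≤1+n (factor-length (proj₁ (∈-palFactors⁻ V u∈)))
    W∉ : W ∉ w ∷ palFactors V
    W∉ W∈ = 1+n≰n (subst (_≤ length X) length-W (short W∈))

  card-w∷palFactors-V : IsRich W → card (w ∷ palFactors V) ≡ suc (length V + 1)
  card-w∷palFactors-V richW = suc-injective (trans (sym palFactors-W) (trans richW (cong (_+ 1) length-W)))

  rich-V : IsRich W → IsRich V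
  rich-V richW = ≤-antisym (palFactors-bound V)
    (s≤s⁻¹ (subst (_≤ suc (card (palFactors V))) (card-w∷palFactors-V richW) (card-∷-≤ w (palFactors V))))

  w-new : IsRich W → ¬ Factor w V
  w-new richW w∈V = 1+n≰n (begin
    suc (length V + 1)         ≡⟨ sym (card-w∷palFactors-V richW) ⟩
    card (w ∷ palFactors V)    ≡⟨ card-∷-∈ (∈-palFactors⁺ (w∈V , palindrome)) ⟩
    card (palFactors V)        ≤⟨ palFactors-bound V ⟩
    length V + 1               ∎)
    where open ≤-Reasoning

  pre : ℕ → Word k
  pre n = take n X

  length-pre : {n : ℕ} → n ≤ length X → length (pre n) ≡ n
  length-pre {n} n≤ = trans (length-take n X) (m≤n⇒m⊓n≡m n≤)

  length-reverse-pre : {n : ℕ} → n ≤ length X → length (reverse (pre n)) ≡ n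
  length-reverse-pre {n} n≤ = trans (length-reverse (pre n)) (length-pre n≤)

  factorsOfLength-W : {n : ℕ} → n ≤ length X →
                      factorsOfLength n W ∼[ set ] (pre n ∷ reverse (pre n) ∷ factorsOfLength n V)
  factorsOfLength-W {n} n≤ = mk⇔ to from
    where
    pre-of-W : Prefix (pre n) W
    pre-of-W = prefix-trans (prefix-take n X) ([ a ] , refl)
    to : ∀ {u} → u ∈ factorsOfLength n W → u ∈ pre n ∷ reverse (pre n) ∷ factorsOfLength n V
    to {u} u∈ with ∈-factorsOfLength⁻ n W u∈
    ... | f , e with factor-∷⁻ f
    ...   | inj₂ pu = here (prefix-unique pu pre-of-W (trans e (sym (length-pre n≤))))
    ...   | inj₁ g with factor-∷⁻ (subst (Factor (reverse u)) reverse-Va (factor-reverse g))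
    ...     | inj₁ h = there (there (∈-factorsOfLength⁺ (reverse-factor-V h) e))
    ...     | inj₂ q = there (here (trans (sym (reverse-involutive u)) (cong reverse (prefix-unique q (prefix-take n X)
                         (trans (length-reverse u) (trans e (sym (length-pre n≤))))))))
    from : ∀ {u} → u ∈ pre n ∷ reverse (pre n) ∷ factorsOfLength n V → u ∈ factorsOfLength n W
    from (here refl) = ∈-factorsOfLength⁺ (prefix⇒factor pre-of-W) (length-pre n≤)
    from (there (here refl)) =
      ∈-factorsOfLength⁺ (factor-∷⁺ a (subst (Factor _) reverse-X (factor-reverse (prefix⇒factor (prefix-take n X)))))
                         (length-reverse-pre n≤)
    from (there (there u∈)) with ∈-factorsOfLength⁻ n V u∈
    ... | f , e = ∈-factorsOfLength⁺ (factor-V⇒W f) e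

  module _ (w∉V : ¬ Factor w V) where

    C-extension : {n : ℕ} → n ≤ length X → C W n ≡ newFactors ℓ n + C V n
    C-extension {n} n≤ with <-cmp n ℓ
    ... | tri< n<ℓ _ _ = begin
        C W n                                                ≡⟨ card-cong (factorsOfLength-W n≤) ⟩
        card (pre n ∷ reverse (pre n) ∷ factorsOfLength n V) ≡⟨ card-∷-∈ (there pre∈V) ⟩
        card (reverse (pre n) ∷ factorsOfLength n V)         ≡⟨ card-∷-∈ rev∈V ⟩
        C V n                                                ≡⟨ cong (_+ C V n) (sym (newFactors-< n<ℓ)) ⟩
        newFactors ℓ n + C V n                               ∎
      where
      open ≡-Reasoning
      -- pre n is a proper prefix of the palindrome w, so its reversal occurs in V, and so does it.
      rev-factor : Factor (reverse (pre n)) V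
      rev-factor = reverse-proper-prefix
        (prefix-≤ (prefix-take n X) prefix (≤-trans (≤-reflexive (length-pre n≤)) (<⇒≤ n<ℓ)))
        palindrome (subst (_< ℓ) (sym (length-pre n≤)) n<ℓ) prefix
      rev∈V : reverse (pre n) ∈ factorsOfLength n V
      rev∈V = ∈-factorsOfLength⁺ rev-factor (length-reverse-pre n≤)
      pre∈V : pre n ∈ factorsOfLength n V
      pre∈V = ∈-factorsOfLength⁺ (reverse-factor-V rev-factor) (length-pre n≤)
    ... | tri≈ _ refl _ = begin
        C W ℓ                                                ≡⟨ card-cong (factorsOfLength-W n≤) ⟩
        card (pre ℓ ∷ reverse (pre ℓ) ∷ factorsOfLength ℓ V) ≡⟨ card-∷-∈ {xs = reverse (pre ℓ) ∷ factorsOfLength ℓ V} pre∈ ⟩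
        card (reverse (pre ℓ) ∷ factorsOfLength ℓ V)         ≡⟨ card-∷-∉ {xs = factorsOfLength ℓ V} rev∉V ⟩
        1 + C V ℓ                                            ≡⟨ cong (_+ C V ℓ) (sym (newFactors-≡ ℓ)) ⟩
        newFactors ℓ ℓ + C V ℓ                               ∎
      where
      open ≡-Reasoning
      -- Here pre ℓ = w, a palindrome that does not occur in V.
      pre≡w : pre ℓ ≡ w
      pre≡w = prefix-unique (prefix-take ℓ X) prefix (length-pre n≤)
      rev≡w : reverse (pre ℓ) ≡ w
      rev≡w = trans (cong reverse pre≡w) palindrome
      pre∈ : pre ℓ ∈ reverse (pre ℓ) ∷ factorsOfLength ℓ V
      pre∈ = here (trans pre≡w (sym rev≡w))
      rev∉V : reverse (pre ℓ) ∉ factorsOfLength ℓ V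
      rev∉V rev∈ = w∉V (subst (λ z → Factor z V) rev≡w (proj₁ (∈-factorsOfLength⁻ ℓ V rev∈)))
    ... | tri> _ _ ℓ<n = begin
        C W n                                                ≡⟨ card-cong (factorsOfLength-W n≤) ⟩
        card (pre n ∷ reverse (pre n) ∷ factorsOfLength n V) ≡⟨ card-∷-∉ pre∉ ⟩
        1 + card (reverse (pre n) ∷ factorsOfLength n V)     ≡⟨ cong suc (card-∷-∉ rev∉V) ⟩
        2 + C V n                                            ≡⟨ cong (_+ C V n) (sym (newFactors-> ℓ<n)) ⟩
        newFactors ℓ n + C V n                               ∎
      where
      open ≡-Reasoning
      -- pre n extends w, so neither it nor its reversal occurs in V; and it is not a palindrome.
      pre-not-factor : ¬ Factor (pre n) V
      pre-not-factor f = w∉V (factor-trans (prefix⇒factor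
        (prefix-≤ prefix (prefix-take n X) (≤-trans (<⇒≤ ℓ<n) (≤-reflexive (sym (length-pre n≤)))))) f)
      rev∉V : reverse (pre n) ∉ factorsOfLength n V
      rev∉V = pre-not-factor ∘ reverse-factor-V ∘ proj₁ ∘ ∈-factorsOfLength⁻ n V
      pre∉ : pre n ∉ reverse (pre n) ∷ factorsOfLength n V
      pre∉ (here pre≡rev) = <⇒≱ ℓ<n (subst (_≤ ℓ) (length-pre n≤) (longest (prefix-take n X) (sym pre≡rev)))
      pre∉ (there pre∈) = pre-not-factor (proj₁ (∈-factorsOfLength⁻ n V pre∈))

    P-extension : {n : ℕ} → n ≤ length X → P W n ≡ newPalindromes ℓ n + P V n
    P-extension {n} n≤ with n ≟ ℓ
    ... | yes refl = begin
        P W ℓ                              ≡⟨ card-cong (mk⇔ to from) ⟩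
        card (w ∷ palFactorsOfLength ℓ V)  ≡⟨ card-∷-∉ {xs = palFactorsOfLength ℓ V} (w∉V ∘ proj₁ ∘ proj₁ ∘ ∈-palFactorsOfLength⁻ ℓ V) ⟩
        1 + P V ℓ                          ≡⟨ cong (_+ P V ℓ) (sym (newPalindromes-≡ ℓ)) ⟩
        newPalindromes ℓ ℓ + P V ℓ         ∎
      where
      open ≡-Reasoning
      to : ∀ {u} → u ∈ palFactorsOfLength ℓ W → u ∈ w ∷ palFactorsOfLength ℓ V
      to u∈ with ∈-palFactorsOfLength⁻ ℓ W u∈
      ... | pf@(_ , palu) , e with short-palFactor-W pf (subst (_≤ length X) (sym e) n≤)
      ...   | inj₁ refl = here refl
      ...   | inj₂ f = there (∈-palFactorsOfLength⁺ (f , palu) e)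
      from : ∀ {u} → u ∈ w ∷ palFactorsOfLength ℓ V → u ∈ palFactorsOfLength ℓ W
      from (here refl) = ∈-palFactorsOfLength⁺ w-palFactor-W refl
      from (there u∈) = palFactorsOfLength-V⇒W ℓ u∈
    ... | no n≢ℓ = begin
        P W n                       ≡⟨ card-cong (mk⇔ to (palFactorsOfLength-V⇒W n)) ⟩
        P V n                       ≡⟨ cong (_+ P V n) (sym (newPalindromes-≢ n≢ℓ)) ⟩
        newPalindromes ℓ n + P V n  ∎
      where
      open ≡-Reasoning
      to : ∀ {u} → u ∈ palFactorsOfLength n W → u ∈ palFactorsOfLength n V
      to u∈ with ∈-palFactorsOfLength⁻ n W u∈
      ... | pf@(_ , palu) , e with short-palFactor-W pf (subst (_≤ length X) (sym e) n≤)
      ...   | inj₁ refl = ⊥-elim (n≢ℓ (sym e))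
      ...   | inj₂ f = ∈-palFactorsOfLength⁺ (f , palu) e

    -- At the top length N = |X| the new palindromes and factors make up for V having none.
    top-equation : Equation W (length X)
    top-equation = begin
        P W N + P W (suc N) + C W N
          ≡⟨ cong₂ _+_ (cong₂ _+_ (P-extension ≤-refl) P-W-top) (C-extension ≤-refl) ⟩
        (newPalindromes ℓ N + P V N) + 1 + (newFactors ℓ N + C V N)
          ≡⟨ cong₂ (λ p c → (newPalindromes ℓ N + p) + 1 + (newFactors ℓ N + c)) (P-beyond V ≤-refl) (C-beyond V ≤-refl) ⟩
        (newPalindromes ℓ N + 0) + 1 + (newFactors ℓ N + 0)
          ≡⟨ regroup (newPalindromes ℓ N) (newFactors ℓ N) ⟩
        (newPalindromes ℓ N + newFactors ℓ N) + 1
          ≡⟨ cong (_+ 1) (newCounts-top ℓ≤|X|) ⟩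
        1 + 2
          ≡⟨ cong (_+ 2) (sym C-W-top) ⟩
        C W (suc N) + 2  ∎
      where
      open ≡-Reasoning
      N : ℕ
      N = length X
      regroup : ∀ x y → (x + 0) + 1 + (y + 0) ≡ (x + y) + 1
      regroup = solve-∀
      P-W-top : P W (suc N) ≡ 1
      P-W-top = subst (λ m → P W m ≡ 1) length-W (P-length W palW)
      C-W-top : C W (suc N) ≡ 1
      C-W-top = subst (λ m → C W m ≡ 1) length-W (C-length W)

    equations-extension : Equations V → Equations W
    equations-extension eqV n n≤|W| with n ≤? length V
    ... | yes n≤|V| = begin
        P W n + P W (suc n) + C W n
          ≡⟨ cong₂ _+_ (cong₂ _+_ (P-extension n≤|X|) (P-extension (s≤s n≤|V|))) (C-extension n≤|X|) ⟩
        (newPalindromes ℓ n + P V n) + (newPalindromes ℓ (suc n) + P V (suc n)) + (newFactors ℓ n + C V n)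
          ≡⟨ add-increments {x = newPalindromes ℓ n} {newPalindromes ℓ (suc n)} {newFactors ℓ n}
                            (newCounts-step ℓ n) (eqV n n≤|V|) ⟩
        (newFactors ℓ (suc n) + C V (suc n)) + 2
          ≡⟨ cong (_+ 2) (sym (C-extension (s≤s n≤|V|))) ⟩
        C W (suc n) + 2  ∎
      where
      open ≡-Reasoning
      n≤|X| : n ≤ length X
      n≤|X| = m≤n⇒m≤1+n n≤|V|
    ... | no n≰|V| with n ≟ length X
    ...   | yes refl = top-equation
    ...   | no n≢|X| = subst (Equation W) (sym n≡|W|) (equation-at-length W palW)
      where
      n≡|W| : n ≡ length W
      n≡|W| = ≤-antisym n≤|W| (subst (_≤ n) (sym length-W) (≤∧≢⇒< (≰⇒> n≰|V|) (n≢|X| ∘ sym)))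

module _ {k : ℕ} where
  open Distinct (_≟w_ {k})

  palindrome-induction : (Q : Word k → Set) → Q [] → (∀ a → Q [ a ]) →
                         (∀ a V → IsPalindrome V → Q V → Q (a ∷ (V ++ [ a ]))) →
                         ∀ W → IsPalindrome W → Q W
  palindrome-induction Q base₀ base₁ step W = go (length W) W ≤-refl
    where
    -- Comparing a ∷ V ++ [b] with its reversal b ∷ reverse V ++ [a] gives a = b and V palindromic.
    reverse-wrap : ∀ a V b → reverse (a ∷ (V ++ [ b ])) ≡ b ∷ (reverse V ++ [ a ])
    reverse-wrap a V b = trans (reverse-++ [ a ] (V ++ [ b ])) (cong (_++ [ a ]) (reverse-++ V [ b ]))
    go : ∀ m W → length W ≤ m → IsPalindrome W → Q W
    go _ [] _ _ = base₀
    go m (a ∷ T) _ _ with reverseView T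
    go _ (a ∷ .[]) _ _ | reverse-[] = base₁ a
    go (suc m) (a ∷ .(V ++ [ b ])) (s≤s |T|≤m) pal | V ∶ _ ∶ʳ b
      with ∷-injective (trans (sym (reverse-wrap a V b)) pal)
    ... | refl , e = step a V palV (go m V |V|≤m palV)
      where
      palV : IsPalindrome V
      palV = ∷ʳ-injectiveˡ (reverse V) V e
      |V|≤m : length V ≤ m
      |V|≤m = ≤-trans (m≤m+n (length V) 1) (subst (_≤ m) (length-++ V) |T|≤m)

  rich-palindrome⇒equations : (W : Word k) → IsRich W → IsPalindrome W → Equations W
  rich-palindrome⇒equations W richW palW =
    palindrome-induction (λ W → IsRich W → Equations W) (λ _ → equations-[]) (λ a _ → equations-[a] a) extend W palW richW
    where
    equations-[] : Equations {k} []
    equations-[] zero z≤n = equation-at-length {k} [] refl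
    equations-[a] : ∀ a → Equations [ a ]
    equations-[a] a zero _ rewrite P-zero [ a ] | P-length [ a ] refl | C-zero [ a ] | C-length [ a ] = refl
    equations-[a] a (suc zero) _ = equation-at-length [ a ] refl
    equations-[a] a (suc (suc n)) (s≤s ())
    extend : ∀ a V → IsPalindrome V → (IsRich V → Equations V) → IsRich (a ∷ (V ++ [ a ])) → Equations (a ∷ (V ++ [ a ]))
    extend a V palV eqV richW with longestPalPrefix (a ∷ V)
    ... | w , L = equations-extension (w-new richW) (eqV (rich-V richW))
      where open Extension a V palV w L


sumBelow : (ℕ → ℕ) → ℕ → ℕ
sumBelow f zero    = 0
sumBelow f (suc m) = sumBelow f m + f m

telescope : {p c : ℕ → ℕ} (M : ℕ) → (∀ n → n < M → p n + p (suc n) + c n ≡ c (suc n) + 2) →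
            sumBelow p M + sumBelow p M + p M + c 0 ≡ c M + (M + M) + p 0
telescope {p} {c} zero _ = shuffle (p 0) (c 0)
  where
  shuffle : ∀ x y → x + y ≡ y + 0 + x
  shuffle = solve-∀
telescope {p} {c} (suc M) eqs = begin
    (S + p M) + (S + p M) + p (suc M) + c 0         ≡⟨ regroup₁ S (p M) (p (suc M)) (c 0) ⟩
    (S + S + p M + c 0) + (p M + p (suc M))         ≡⟨ cong (_+ (p M + p (suc M))) (telescope M (λ n n<M → eqs n (m<n⇒m<1+n n<M))) ⟩
    (c M + (M + M) + p 0) + (p M + p (suc M))       ≡⟨ regroup₂ (c M) M (p 0) (p M) (p (suc M)) ⟩
    (p M + p (suc M) + c M) + (M + M) + p 0         ≡⟨ cong (λ z → z + (M + M) + p 0) (eqs M ≤-refl) ⟩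
    (c (suc M) + 2) + (M + M) + p 0                 ≡⟨ regroup₃ (c (suc M)) M (p 0) ⟩
    c (suc M) + (suc M + suc M) + p 0               ∎
  where
  open ≡-Reasoning
  S : ℕ
  S = sumBelow p M
  regroup₁ : ∀ s x y z → (s + x) + (s + x) + y + z ≡ (s + s + x + z) + (x + y)
  regroup₁ = solve-∀
  regroup₂ : ∀ c m q x y → (c + (m + m) + q) + (x + y) ≡ (x + y + c) + (m + m) + q
  regroup₂ = solve-∀
  regroup₃ : ∀ c m q → (c + 2) + (m + m) + q ≡ c + (suc m + suc m) + q
  regroup₃ = solve-∀

half-injective : {m n : ℕ} → m + m ≡ n + n → m ≡ n
half-injective {m} {n} e = trans (n≡⌊n+n/2⌋ m) (trans (cong ⌊_/2⌋ e) (sym (n≡⌊n+n/2⌋ n)))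

module _ {k : ℕ} where
  open Distinct (_≟w_ {k})

  palFactorsBelow : ℕ → Word k → List (Word k)
  palFactorsBelow zero    W = []
  palFactorsBelow (suc m) W = palFactorsOfLength m W ++ palFactorsBelow m W

  ∈-palFactorsBelow⁻ : (m : ℕ) (W : Word k) {u : Word k} → u ∈ palFactorsBelow m W → PalFactor u W × length u < m
  ∈-palFactorsBelow⁻ (suc m) W u∈ with ∈-++⁻ (palFactorsOfLength m W) u∈
  ... | inj₁ u∈ₘ = let (pf , e) = ∈-palFactorsOfLength⁻ m W u∈ₘ in pf , s≤s (≤-reflexive e)
  ... | inj₂ u∈< = let (pf , lt) = ∈-palFactorsBelow⁻ m W u∈< in pf , m<n⇒m<1+n lt

  ∈-palFactorsBelow⁺ : (m : ℕ) {u W : Word k} → PalFactor u W → length u < m → u ∈ palFactorsBelow m W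
  ∈-palFactorsBelow⁺ (suc m) {u} {W} pf lt with length u ≟ m
  ... | yes e = ∈-++⁺ˡ (∈-palFactorsOfLength⁺ pf e)
  ... | no ne = ∈-++⁺ʳ (palFactorsOfLength m W) (∈-palFactorsBelow⁺ m pf (≤∧≢⇒< (s≤s⁻¹ lt) ne))

  card-palFactorsBelow : (m : ℕ) (W : Word k) → card (palFactorsBelow m W) ≡ sumBelow (P W) m
  card-palFactorsBelow zero    W = refl
  card-palFactorsBelow (suc m) W = begin
      card (palFactorsOfLength m W ++ palFactorsBelow m W)  ≡⟨ card-++ disjoint ⟩
      P W m + card (palFactorsBelow m W)                    ≡⟨ cong (P W m +_) (card-palFactorsBelow m W) ⟩
      P W m + sumBelow (P W) m                              ≡⟨ +-comm (P W m) _ ⟩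
      sumBelow (P W) m + P W m                              ∎
    where
    open ≡-Reasoning
    disjoint : Disjoint (palFactorsOfLength m W) (palFactorsBelow m W)
    disjoint (u∈ₘ , u∈<) = <-irrefl (proj₂ (∈-palFactorsOfLength⁻ m W u∈ₘ)) (proj₂ (∈-palFactorsBelow⁻ m W u∈<))

  palFactors-by-length : (W : Word k) → card (palFactors W) ≡ sumBelow (P W) (suc (length W))
  palFactors-by-length W = trans (card-cong (mk⇔ to from)) (card-palFactorsBelow (suc (length W)) W)
    where
    to : ∀ {u} → u ∈ palFactors W → u ∈ palFactorsBelow (suc (length W)) W
    to u∈ = let pf = ∈-palFactors⁻ W u∈ in ∈-palFactorsBelow⁺ (suc (length W)) pf (s≤s (factor-length (proj₁ pf)))
    from : ∀ {u} → u ∈ palFactorsBelow (suc (length W)) W → u ∈ palFactors W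
    from u∈ = ∈-palFactors⁺ (proj₁ (∈-palFactorsBelow⁻ (suc (length W)) W u∈))

  -- (B) ⇒ (A).  The equation at n = |W| reads P(|W|) + 0 + 1 = 0 + 2, so P(|W|) = 1 and W is a
  -- palindrome; the telescoped sum of all the equations gives 2·Σ P = 2(|W| + 1).
  equations⇒palindrome : (W : Word k) → Equations W → IsPalindrome W
  equations⇒palindrome W eqs with isPalindrome? W
  ... | yes palW = palW
  ... | no ¬palW = ⊥-elim (1≢2 (begin
      0 + 0 + 1                              ≡⟨ sym (cong₂ _+_ (cong₂ _+_ (P-length-nonpalindrome W ¬palW) (P-beyond W ≤-refl)) (C-length W)) ⟩
      P W L + P W (suc L) + C W L            ≡⟨ eqs L ≤-refl ⟩
      C W (suc L) + 2                        ≡⟨ cong (_+ 2) (C-beyond W ≤-refl) ⟩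
      0 + 2                                  ∎))
    where
    open ≡-Reasoning
    L : ℕ
    L = length W
    1≢2 : 1 ≢ 2
    1≢2 ()

  equations⇒rich : (W : Word k) → Equations W → IsRich W
  equations⇒rich W eqs = begin
      card (palFactors W)  ≡⟨ palFactors-by-length W ⟩
      S                    ≡⟨ half-injective doubled ⟩
      suc L                ≡⟨ +-comm 1 L ⟩
      L + 1                ∎
    where
    open ≡-Reasoning
    L S : ℕ
    L = length W
    S = sumBelow (P W) (suc L)
    doubled : S + S ≡ suc L + suc L
    doubled = +-cancelʳ-≡ 1 _ _ (begin
      S + S + 1                                ≡⟨ cong (_+ 1) (sym (+-identityʳ (S + S))) ⟩
      S + S + 0 + 1                            ≡⟨ sym (cong₂ (λ x y → S + S + x + y) (P-beyond W ≤-refl) (C-zero W)) ⟩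
      S + S + P W (suc L) + C W 0              ≡⟨ telescope (suc L) (λ n n<1+L → eqs n (s≤s⁻¹ n<1+L)) ⟩
      C W (suc L) + (suc L + suc L) + P W 0    ≡⟨ cong₂ (λ x y → x + (suc L + suc L) + y) (C-beyond W ≤-refl) (P-zero W) ⟩
      suc L + suc L + 1                        ∎)

theorem1 : (k : ℕ) (W : Word k) →
    IsRichPalindrome W ⇔
    ((n : ℕ) → n ≤ length W → P W n + P W (suc n) + C W n ≡ C W (suc n) + 2)
theorem1 k W = mk⇔ (λ (richW , palW) → rich-palindrome⇒equations W richW palW)
                   (λ eqs → equations⇒rich W eqs , equations⇒palindrome W eqs)
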